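{- Let $q\ge1$, $\Sigma=\{0,1,\ldots,q-1\}$ and let $n$ be odd. Then $$BBF_{n+1}^q=\Big(\bigcup_{T\in BBF_n^q}\psi(T)\Big)\setminus\Big(\bigcup_{D\in BBF_{\frac{n+1}{2}}^q}\varphi(D)\Big).$$
   Context: For an $m\times m$ matrix $T$ over $\Sigma$ and $1\le r<m$, the $r\times r$ biprefix of $T$ is $T[1\ldots r,1\ldots r]$ and the $r\times r$ bisuffix is $T[m-r+1\ldots m,\,m-r+1\ldots m]$. $T$ is bibifix-free if for no $1\le r<m$ the $r\times r$ biprefix equals the $r\times r$ bisuffix. $BBF_m^q$ denotes the set of all $m\times m$ bibifix-free matrices over $\Sigma$. For an $n\times n$ matrix $M$ over $\Sigma$, let $h=\lfloor n/2\rfloor$; $\psi(M)$ is the set of all $(n+1)\times(n+1)$ matrices $T'$ over $\Sigma$ with $T'[i,j]=M[\iota(i),\iota(j)]$ for all $i,j\neq h+1$, where $\iota(i)=i$ if $i\le h$ and $\iota(i)=i-1$ if $i\ge h+2$, and with arbitrary entries in row $h+1$ and column $h+1$. For an $m\times m$ matrix $D$ over $\Sigma$, $\varphi(D)$ is the set of all $2m\times 2m$ matrices $N$ over $\Sigma$ with $N[1\ldots m,1\ldots m]=D$ and $N[m+1\ldots 2m,\,m+1\ldots 2m]=D$, all other entries being arbitrary elements of $\Sigma$. -}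

module Defs where

open import Data.Nat using (ℕ; zero; suc; _+_; _∸_; _<_; _≤_; _/_)
open import Data.Fin using (Fin; toℕ)
open import Data.Product using (_×_; Σ; ∃)
open import Relation.Nullary using (¬_)
open import Relation.Binary.PropositionalEquality using (_≡_; _≢_)
open import Data.Bool using (if_then_else_)
open import Data.Nat using (_<ᵇ_)

-- An m×m matrix over Σ = {0,…,q-1}; indices are 0-based (row i ↔ paper's row i+1).
Mat : ℕ → ℕ → Set
Mat m q = Fin m → Fin m → Fin q

-- The r×r biprefix of T equals its r×r bisuffix (entrywise):
-- T[a,b] = T[m-r+a, m-r+b] for all 0 ≤ a,b < r (0-based).
-- Indices are related through toℕ so that no bound proofs are needed.
BiprefixEqBisuffix : {m q : ℕ} → Mat m q → ℕ → Set
BiprefixEqBisuffix {m} T r =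
  (a b : Fin r) (i j i′ j′ : Fin m) →
  toℕ i ≡ toℕ a → toℕ j ≡ toℕ b →
  toℕ i′ ≡ (m ∸ r) + toℕ a → toℕ j′ ≡ (m ∸ r) + toℕ b →
  T i j ≡ T i′ j′

BBF : (m q : ℕ) → Mat m q → Set
BBF m q T = (r : ℕ) → 1 ≤ r → r < m → ¬ BiprefixEqBisuffix T r

-- ι in 0-based form, with h = ⌊n/2⌋: 0-based row h is the paper's row h+1
-- (the free row); rows before it are kept, rows after it shift down by one.
ι : ℕ → ℕ → ℕ
ι h i = if i <ᵇ h then i else i ∸ 1

InPsi : {n q : ℕ} → Mat n q → Mat (suc n) q → Set
InPsi {n} M T′ =
  (i j : Fin (suc n)) (a b : Fin n) →
  toℕ i ≢ n / 2 → toℕ j ≢ n / 2 →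
  toℕ a ≡ ι (n / 2) (toℕ i) → toℕ b ≡ ι (n / 2) (toℕ j) →
  T′ i j ≡ M a b

InPhi : {m p q : ℕ} → Mat m q → Mat p q → Set
InPhi {m} {p} D N =
  (p ≡ m + m) ×
  ((i j : Fin p) (a b : Fin m) →
     toℕ i ≡ toℕ a → toℕ j ≡ toℕ b → N i j ≡ D a b) ×
  ((i j : Fin p) (a b : Fin m) →
     toℕ i ≡ m + toℕ a → toℕ j ≡ m + toℕ b → N i j ≡ D a b)

module Submission where

-- Read a matrix as an array indexed by naturals. An equal r×r
-- biprefix and bisuffix of an m×m matrix is a "border" of size r and shift
-- m ∸ r. Composing a border with itself shows that a matrix has a border iff it
-- has a short one (size ≤ shift), so bibifix-freeness means: no short border.
-- For n = 2h+1 the short borders of an (n+1)×(n+1) matrix T′ have size ≤ h or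
-- are the repetition of its first half (size = shift = h+1).
-- * Those of size ≤ h lie before the middle row/column h while their copies
--   lie after it, so they correspond exactly to the short borders of the
--   n×n matrix T obtained by deleting that row and column (T′ ∈ ψ(T)).
-- * The repeated first half D is exactly T′ ∈ φ(D); and every short border
--   of D yields a border of T′ of size ≤ h, so D is bibifix-free whenever T is.

open import Defs
open import Data.Nat using (ℕ; suc; _+_; _*_; _≤_; _/_)
open import Data.Product using (_×_; Σ-syntax)
open import Relation.Nullary using (¬_)
open import Relation.Binary.PropositionalEquality using (_≡_)
open import Function.Bundles using (_⇔_)

open import Data.Bool using (true; false; if_then_else_)
open import Data.Empty using (⊥; ⊥-elim)
open import Data.Fin using (Fin; toℕ; fromℕ<) renaming (zero to fzero)
open import Data.Fin.Properties using (toℕ<n; fromℕ<-toℕ; toℕ-fromℕ<)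
open import Data.Nat using (zero; _<_; _∸_; _<ᵇ_; z≤n; s≤s; _<?_; _≤?_)
open import Data.Nat.DivMod using (m/n≡1+[m∸n]/n)
open import Data.Nat.Induction using (<-rec)
open import Data.Nat.Properties
open import Data.Product using (_,_)
open import Data.Sum using (_⊎_; inj₁; inj₂)
open import Data.Unit using (tt)
open import Function.Bundles using (mk⇔; Equivalence)
open import Relation.Nullary using (yes; no)
open import Relation.Binary.PropositionalEquality
  using (_≢_; refl; sym; trans; cong; cong₂; subst; subst₂; module ≡-Reasoning)
open ≡-Reasoning

private variable
  X : Set
  A A′ : ℕ → ℕ → X
  a b e h m n p q r s x y : ℕ

-- The entry of T at (i, j), or a fixed default outside the matrix.
at : Mat m (suc q) → ℕ → ℕ → Fin (suc q)
at {m} T i j with i <? m | j <? m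
... | yes i<m | yes j<m = T (fromℕ< i<m) (fromℕ< j<m)
... | _       | _       = fzero

at-inside : (T : Mat m (suc q)) (x<m : x < m) (y<m : y < m) →
  at T x y ≡ T (fromℕ< x<m) (fromℕ< y<m)
at-inside {m} {x = x} {y} T x<m y<m with x <? m | y <? m
... | yes _   | yes _   = refl
... | no x≮m  | _       = ⊥-elim (x≮m x<m)
... | yes _   | no y≮m  = ⊥-elim (y≮m y<m)

at-toℕ : (T : Mat m (suc q)) (i j : Fin m) → at T (toℕ i) (toℕ j) ≡ T i j
at-toℕ T i j =
  trans (at-inside T (toℕ<n i) (toℕ<n j)) (cong₂ T (fromℕ<-toℕ i _) (fromℕ<-toℕ j _))

block-index : r + p ≤ m → a < r → a < m
block-index {r} {p} r+p≤m a<r = <-≤-trans a<r (≤-trans (m≤m+n r p) r+p≤m)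

copy-index : r + p ≤ m → a < r → p + a < m
copy-index {r} {p} r+p≤m a<r =
  <-≤-trans (+-monoʳ-< p a<r) (≤-trans (≤-reflexive (+-comm p r)) r+p≤m)

Border : (ℕ → ℕ → X) → ℕ → ℕ → Set
Border A p s = ∀ a b → a < s → b < s → A a b ≡ A (p + a) (p + b)

border-restrict : s ≤ r → Border A p r → Border A p s
border-restrict s≤r B a b a<s b<s = B a b (<-≤-trans a<s s≤r) (<-≤-trans b<s s≤r)

border-compose : e + s ≤ r → Border A p r → Border A e s → Border A (p + e) s
border-compose {e} {s} {r} {A = A} {p} e+s≤r Bp Be a b a<s b<s = begin
  A a b                         ≡⟨ Be a b a<s b<s ⟩
  A (e + a) (e + b)             ≡⟨ Bp (e + a) (e + b) (inside a<s) (inside b<s) ⟩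
  A (p + (e + a)) (p + (e + b)) ≡⟨ cong₂ A (sym (+-assoc p e a)) (sym (+-assoc p e b)) ⟩
  A (p + e + a) (p + e + b)     ∎
  where
  inside : x < s → e + x < r
  inside x<s = <-≤-trans (+-monoʳ-< e x<s) e+s≤r

-- A border only involves entries in [0, s + p)², so arrays agreeing on a
-- square containing that region have the same borders.
border-agree : (∀ a b → a < m → b < m → A a b ≡ A′ a b) → s + p ≤ m →
  Border A p s → Border A′ p s
border-agree {m} {A = A} {A′} {s} {p} agree s+p≤m B a b a<s b<s = begin
  A′ a b
    ≡⟨ sym (agree a b (block-index s+p≤m a<s) (block-index s+p≤m b<s)) ⟩
  A a b
    ≡⟨ B a b a<s b<s ⟩
  A (p + a) (p + b)
    ≡⟨ agree (p + a) (p + b) (copy-index s+p≤m a<s) (copy-index s+p≤m b<s) ⟩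
  A′ (p + a) (p + b) ∎

shift≡ : r + p ≡ m → m ∸ r ≡ p
shift≡ {r} {p} r+p≡m = trans (cong (_∸ r) (sym r+p≡m)) (m+n∸m≡n r p)

bisuffix→border : (T : Mat m (suc q)) → r + p ≡ m →
  BiprefixEqBisuffix T r → Border (at T) p r
bisuffix→border {m} {r = r} {p} T r+p≡m E a b a<r b<r = begin
  at T a b
    ≡⟨ at-inside T (block-index r+p≤m a<r) (block-index r+p≤m b<r) ⟩
  T (fromℕ< _) (fromℕ< _)
    ≡⟨ E (fromℕ< a<r) (fromℕ< b<r) _ _ _ _
         (same a<r) (same b<r) (shifted a<r) (shifted b<r) ⟩
  T (fromℕ< _) (fromℕ< _)
    ≡⟨ sym (at-inside T (copy-index r+p≤m a<r) (copy-index r+p≤m b<r)) ⟩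
  at T (p + a) (p + b) ∎
  where
  r+p≤m : r + p ≤ m
  r+p≤m = ≤-reflexive r+p≡m
  same : (x<r : x < r) → toℕ (fromℕ< (block-index r+p≤m x<r)) ≡ toℕ (fromℕ< x<r)
  same x<r = trans (toℕ-fromℕ< _) (sym (toℕ-fromℕ< x<r))
  shifted : (x<r : x < r) →
    toℕ (fromℕ< (copy-index r+p≤m x<r)) ≡ (m ∸ r) + toℕ (fromℕ< x<r)
  shifted x<r =
    trans (toℕ-fromℕ< _) (cong₂ _+_ (sym (shift≡ r+p≡m)) (sym (toℕ-fromℕ< x<r)))

border→bisuffix : (T : Mat m (suc q)) → r + p ≡ m →
  Border (at T) p r → BiprefixEqBisuffix T r
border→bisuffix {m} {r = r} {p} T r+p≡m B a b i j i′ j′ i≡a j≡b i′≡ j′≡ = begin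
  T i j                              ≡⟨ sym (at-toℕ T i j) ⟩
  at T (toℕ i) (toℕ j)               ≡⟨ cong₂ (at T) i≡a j≡b ⟩
  at T (toℕ a) (toℕ b)               ≡⟨ B (toℕ a) (toℕ b) (toℕ<n a) (toℕ<n b) ⟩
  at T (p + toℕ a) (p + toℕ b)       ≡⟨ cong₂ (at T) (shift i′≡) (shift j′≡) ⟩
  at T (toℕ i′) (toℕ j′)             ≡⟨ at-toℕ T i′ j′ ⟩
  T i′ j′                            ∎
  where
  shift : x ≡ (m ∸ r) + y → p + y ≡ x
  shift {y = y} x≡ = sym (trans x≡ (cong (_+ y) (shift≡ r+p≡m)))

record ShortBorder (A : ℕ → ℕ → X) (m : ℕ) : Set where
  constructor short
  field
    {size shift} : ℕ
    nonempty     : 1 ≤ size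
    size≤shift   : size ≤ shift
    total        : size + shift ≡ m
    border       : Border A shift size

-- Every nonempty border with positive shift gives a short border of the same
-- total length: while p < r, the border of size r ∸ p at shift p + p
-- (the border composed with itself) is strictly smaller.
shorten : ∀ r {p} → 1 ≤ r → 1 ≤ p → Border A p r → ShortBorder A (r + p)
shorten {A = A} = <-rec Shortenable step
  where
  Shortenable : ℕ → Set
  Shortenable r = ∀ {p} → 1 ≤ r → 1 ≤ p → Border A p r → ShortBorder A (r + p)

  step : ∀ r → (∀ {r′} → r′ < r → Shortenable r′) → Shortenable r
  step r shorten′ {p} 1≤r 1≤p B with r ≤? p
  ... | yes r≤p = short 1≤r r≤p refl B
  ... | no r≰p  = subst (ShortBorder A) same-total
        (shorten′ r∸p<r (m<n⇒0<n∸m p<r) (≤-trans 1≤p (m≤m+n p p))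
          (border-compose p+[r∸p]≤r B (border-restrict (m∸n≤m r p) B)))
    where
    p<r : p < r
    p<r = ≰⇒> r≰p
    r∸p<r : r ∸ p < r
    r∸p<r = ∸-monoʳ-< 1≤p (<⇒≤ p<r)
    p+[r∸p]≤r : p + (r ∸ p) ≤ r
    p+[r∸p]≤r = ≤-reflexive (m+[n∸m]≡n (<⇒≤ p<r))
    same-total : r ∸ p + (p + p) ≡ r + p
    same-total = trans (sym (+-assoc (r ∸ p) p p)) (cong (_+ p) (m∸n+n≡m (<⇒≤ p<r)))

bbf⇔noShortBorder : (T : Mat m (suc q)) → BBF m (suc q) T ⇔ (¬ ShortBorder (at T) m)
bbf⇔noShortBorder {m} T = mk⇔ noShort bbf
  where
  noShort : BBF m _ T → ¬ ShortBorder (at T) m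
  noShort bbf (short {s} {e} 1≤s s≤e s+e≡m B) =
    bbf s 1≤s (<-≤-trans (m<m+n s (≤-trans 1≤s s≤e)) (≤-reflexive s+e≡m))
        (border→bisuffix T s+e≡m B)

  bbf : ¬ ShortBorder (at T) m → BBF m _ T
  bbf none r 1≤r r<m E = none (subst (ShortBorder (at T)) r+[m∸r]≡m
    (shorten r 1≤r (m<n⇒0<n∸m r<m) (bisuffix→border T r+[m∸r]≡m E)))
    where
    r+[m∸r]≡m : r + (m ∸ r) ≡ m
    r+[m∸r]≡m = m+[n∸m]≡n (<⇒≤ r<m)

short-size : s ≤ e → s + e < suc m + suc m → s ≤ m
short-size {s} {e} {m} s≤e s+e< with s ≤? m
... | yes s≤m = s≤m
... | no s≰m  = ⊥-elim (<⇒≱ s+e< (+-mono-≤ m<s (≤-trans m<s s≤e)))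
  where
  m<s : m < s
  m<s = ≰⇒> s≰m

even-split : p ≡ m + m → (B : ShortBorder A p) →
  ShortBorder.size B < m ⊎ Border A m m
even-split {m = m} {A = A} p≡m+m (short {s} {e} _ s≤e s+e≡p B) with s <? m
... | yes s<m = inj₁ s<m
... | no s≮m  = inj₂ (subst₂ (Border A) e≡m s≡m B)
  where
  s+e≡m+m : s + e ≡ m + m
  s+e≡m+m = trans s+e≡p p≡m+m
  s≡m : s ≡ m
  s≡m = ≤-antisym (short-size s≤e (subst (_< suc m + suc m) (sym s+e≡m+m)
                                      (+-mono-< ≤-refl ≤-refl)))
                  (≮⇒≥ s≮m)
  e≡m : e ≡ m
  e≡m = +-cancelˡ-≡ m e m (trans (cong (_+ e) (sym s≡m)) s+e≡m+m)

if-below : {x y : X} → a < h → (if a <ᵇ h then x else y) ≡ x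
if-below {a = a} {h = h} a<h with a <ᵇ h | <⇒<ᵇ a<h
... | true | _ = refl

if-above : {x y : X} → h ≤ a → (if a <ᵇ h then x else y) ≡ y
if-above {h = h} {a = a} h≤a with a <ᵇ h | <ᵇ⇒< a h
... | true  | a<h = ⊥-elim (<⇒≱ (a<h tt) h≤a)
... | false | _   = refl

-- skip h a is the row of the (n+1)×(n+1) matrix that holds row a of the
-- n×n matrix when a new row is inserted at index h; it inverts ι h.
skip : ℕ → ℕ → ℕ
skip h a = if a <ᵇ h then a else suc a

skip≢ : skip h a ≢ h
skip≢ {h} {a} with a <? h
... | yes a<h = λ eq → <⇒≢ a<h (trans (sym (if-below a<h)) eq)
... | no a≮h  = λ eq → <⇒≢ (s≤s (≮⇒≥ a≮h)) (sym (trans (sym (if-above (≮⇒≥ a≮h))) eq))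

skip-< : ∀ h → a < n → skip h a < suc n
skip-< {a} h a<n with a <? h
... | yes a<h = subst (_< _) (sym (if-below a<h)) (<-trans a<n (n<1+n _))
... | no a≮h  = subst (_< _) (sym (if-above (≮⇒≥ a≮h))) (s≤s a<n)

ι-skip : ∀ h → ι h (skip h a) ≡ a
ι-skip {a} h with a <? h
... | yes a<h = trans (cong (ι h) (if-below a<h)) (if-below a<h)
... | no a≮h  = trans (cong (ι h) (if-above h≤a)) (if-above (≤-trans h≤a (n≤1+n a)))
  where
  h≤a : h ≤ a
  h≤a = ≮⇒≥ a≮h

skip-ι : ∀ {i} → i ≢ h → skip h (ι h i) ≡ i
skip-ι {h} {i} i≢h with i <? h
... | yes i<h = trans (cong (skip h) (if-below i<h)) (if-below i<h)
... | no i≮h  = skip-above-ι (≤∧≢⇒< (≮⇒≥ i≮h) (λ h≡i → i≢h (sym h≡i)))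
  where
  skip-above-ι : ∀ {i} → h < i → skip h (ι h i) ≡ i
  skip-above-ι {suc i} (s≤s h≤i) =
    trans (cong (skip h) (if-above (≤-trans h≤i (n≤1+n i)))) (if-above h≤i)

Insertion : ℕ → ℕ → (ℕ → ℕ → X) → (ℕ → ℕ → X) → Set
Insertion h n A A′ = ∀ a b → a < n → b < n → A a b ≡ A′ (skip h a) (skip h b)

border-insertion : Insertion h n A A′ → s ≤ h → h ≤ p → s + p ≤ n →
  Border A p s ⇔ Border A′ (suc p) s
border-insertion {h} {n} {A = A} {A′} {s} {p} ins s≤h h≤p s+p≤n = mk⇔ lift lower
  where
  block : a < s → b < s → A a b ≡ A′ a b
  block {a} {b} a<s b<s =
    trans (ins a b (block-index s+p≤n a<s) (block-index s+p≤n b<s))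
          (cong₂ A′ (if-below (<-≤-trans a<s s≤h)) (if-below (<-≤-trans b<s s≤h)))
  copy : a < s → b < s → A (p + a) (p + b) ≡ A′ (suc p + a) (suc p + b)
  copy {a} {b} a<s b<s =
    trans (ins (p + a) (p + b) (copy-index s+p≤n a<s) (copy-index s+p≤n b<s))
          (cong₂ A′ (if-above (≤-trans h≤p (m≤m+n p a)))
                    (if-above (≤-trans h≤p (m≤m+n p b))))
  lift : Border A p s → Border A′ (suc p) s
  lift B a b a<s b<s = begin
    A′ a b                     ≡⟨ sym (block a<s b<s) ⟩
    A a b                      ≡⟨ B a b a<s b<s ⟩
    A (p + a) (p + b)          ≡⟨ copy a<s b<s ⟩
    A′ (suc p + a) (suc p + b) ∎
  lower : Border A′ (suc p) s → Border A p s
  lower B′ a b a<s b<s = begin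
    A a b                      ≡⟨ block a<s b<s ⟩
    A′ a b                     ≡⟨ B′ a b a<s b<s ⟩
    A′ (suc p + a) (suc p + b) ≡⟨ sym (copy a<s b<s) ⟩
    A (p + a) (p + b)          ∎

psi→insertion : {T : Mat n (suc q)} {T′ : Mat (suc n) (suc q)} → n / 2 ≡ h →
  InPsi T T′ → Insertion h n (at T) (at T′)
psi→insertion {n} {h = h} {T = T} {T′} refl ψ a b a<n b<n = begin
  at T a b
    ≡⟨ at-inside T a<n b<n ⟩
  T (fromℕ< a<n) (fromℕ< b<n)
    ≡⟨ sym (ψ _ _ _ _ (avoids a<n) (avoids b<n) (inverse a<n) (inverse b<n)) ⟩
  T′ (fromℕ< (skip-< h a<n)) (fromℕ< (skip-< h b<n))
    ≡⟨ sym (at-inside T′ (skip-< h a<n) (skip-< h b<n)) ⟩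
  at T′ (skip h a) (skip h b)     ∎
  where
  avoids : (x<n : x < n) → toℕ (fromℕ< (skip-< h x<n)) ≢ h
  avoids x<n eq = skip≢ {h} (trans (sym (toℕ-fromℕ< _)) eq)
  inverse : (x<n : x < n) → toℕ (fromℕ< x<n) ≡ ι h (toℕ (fromℕ< (skip-< h x<n)))
  inverse x<n =
    trans (toℕ-fromℕ< x<n) (sym (trans (cong (ι h) (toℕ-fromℕ< _)) (ι-skip h)))

delete : ℕ → Mat (suc n) (suc q) → Mat n (suc q)
delete h T′ a b = at T′ (skip h (toℕ a)) (skip h (toℕ b))

delete-psi : n / 2 ≡ h → (T′ : Mat (suc n) (suc q)) → InPsi (delete h T′) T′
delete-psi {h = h} refl T′ i j a b i≢h j≢h a≡ b≡ = begin
  T′ i j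
    ≡⟨ sym (at-toℕ T′ i j) ⟩
  at T′ (toℕ i) (toℕ j)
    ≡⟨ cong₂ (at T′) (reinsert i≢h a≡) (reinsert j≢h b≡) ⟩
  at T′ (skip h (toℕ a)) (skip h (toℕ b)) ∎
  where
  reinsert : x ≢ h → y ≡ ι h x → x ≡ skip h y
  reinsert x≢h y≡ = sym (trans (cong (skip h) y≡) (skip-ι x≢h))

copy-after-middle : s ≤ h → s + e ≡ suc (h + h) → h < e
copy-after-middle {s} {h} {e} s≤h s+e≡ =
  +-cancelˡ-≤ h (suc h) e (subst (_≤ h + e) s+e≡′ (+-monoˡ-≤ e s≤h))
  where
  s+e≡′ : s + e ≡ h + suc h
  s+e≡′ = trans s+e≡ (sym (+-suc h h))

odd-length< : suc (h + h) < suc h + suc h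
odd-length< {h} = ≤-reflexive (cong suc (sym (+-suc h h)))

lift-short : Insertion h (suc (h + h)) A A′ →
  ShortBorder A (suc (h + h)) → ShortBorder A′ (suc (suc (h + h)))
lift-short {h} ins (short {s} {e} 1≤s s≤e s+e≡ B) =
  short 1≤s (≤-trans s≤e (n≤1+n e)) (trans (+-suc s e) (cong suc s+e≡))
    (Equivalence.to (border-insertion ins s≤h (<⇒≤ (copy-after-middle s≤h s+e≡))
                      (≤-reflexive s+e≡)) B)
  where
  s≤h : s ≤ h
  s≤h = short-size s≤e (subst (_< suc h + suc h) (sym s+e≡) odd-length<)

lower-short : Insertion h (suc (h + h)) A A′ →
  (B : ShortBorder A′ (suc (suc (h + h)))) → ShortBorder.size B ≤ h →
  ShortBorder A (suc (h + h))
lower-short ins (short {s} {zero} 1≤s s≤0 _ _) _ = ⊥-elim (<⇒≱ 1≤s s≤0)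
lower-short {h} ins (short {s} {suc e} 1≤s _ s+1+e≡ B′) s≤h =
  short 1≤s (≤-trans s≤h (<⇒≤ h<e)) s+e≡
    (Equivalence.from (border-insertion ins s≤h (<⇒≤ h<e) (≤-reflexive s+e≡)) B′)
  where
  s+e≡ : s + e ≡ suc (h + h)
  s+e≡ = suc-injective (trans (sym (+-suc s e)) s+1+e≡)
  h<e : h < e
  h<e = copy-after-middle s≤h s+e≡

top-left : (m : ℕ) → Mat p (suc q) → Mat m (suc q)
top-left m N a b = at N (toℕ a) (toℕ b)

top-left-agrees : (N : Mat p (suc q)) →
  ∀ a b → a < m → b < m → at (top-left m N) a b ≡ at N a b
top-left-agrees N a b a<m b<m =
  trans (at-inside _ a<m b<m) (cong₂ (at N) (toℕ-fromℕ< a<m) (toℕ-fromℕ< b<m))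

phi→border : {D : Mat m (suc q)} {N : Mat p (suc q)} → InPhi D N → Border (at N) m m
phi→border {m} {D = D} {N = N} (p≡m+m , upper , lower) a b a<m b<m = begin
  at N a b
    ≡⟨ at-inside N (block-index m+m≤p a<m) (block-index m+m≤p b<m) ⟩
  N (fromℕ< _) (fromℕ< _)
    ≡⟨ upper _ _ (fromℕ< a<m) (fromℕ< b<m) (same a<m) (same b<m) ⟩
  D (fromℕ< a<m) (fromℕ< b<m)
    ≡⟨ sym (lower _ _ _ _ (shifted a<m) (shifted b<m)) ⟩
  N (fromℕ< _) (fromℕ< _)
    ≡⟨ sym (at-inside N (copy-index m+m≤p a<m) (copy-index m+m≤p b<m)) ⟩
  at N (m + a) (m + b) ∎
  where
  m+m≤p : m + m ≤ _
  m+m≤p = ≤-reflexive (sym p≡m+m)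
  same : (x<m : x < m) → toℕ (fromℕ< (block-index m+m≤p x<m)) ≡ toℕ (fromℕ< x<m)
  same x<m = trans (toℕ-fromℕ< _) (sym (toℕ-fromℕ< x<m))
  shifted : (x<m : x < m) → toℕ (fromℕ< (copy-index m+m≤p x<m)) ≡ m + toℕ (fromℕ< x<m)
  shifted x<m = trans (toℕ-fromℕ< _) (cong (m +_) (sym (toℕ-fromℕ< x<m)))

border→phi : p ≡ m + m → (N : Mat p (suc q)) →
  Border (at N) m m → InPhi (top-left m N) N
border→phi {m = m} p≡m+m N B = p≡m+m , upper , lower
  where
  upper : ∀ i j a b → toℕ i ≡ toℕ a → toℕ j ≡ toℕ b → N i j ≡ top-left m N a b
  upper i j a b i≡a j≡b = trans (sym (at-toℕ N i j)) (cong₂ (at N) i≡a j≡b)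
  lower : ∀ i j a b → toℕ i ≡ m + toℕ a → toℕ j ≡ m + toℕ b →
    N i j ≡ top-left m N a b
  lower i j a b i≡ j≡ = begin
    N i j                            ≡⟨ sym (at-toℕ N i j) ⟩
    at N (toℕ i) (toℕ j)             ≡⟨ cong₂ (at N) i≡ j≡ ⟩
    at N (m + toℕ a) (m + toℕ b)     ≡⟨ sym (B (toℕ a) (toℕ b) (toℕ<n a) (toℕ<n b)) ⟩
    at N (toℕ a) (toℕ b)             ∎

top-left-short : (N : Mat p (suc q)) → p ≡ m + m → Border (at N) m m →
  ShortBorder (at (top-left m N)) m →
  Σ[ B ∈ ShortBorder (at N) p ] ShortBorder.size B < m
top-left-short {m = m} N p≡m+m Bm (short {s} {e} 1≤s s≤e s+e≡m B) =
  short 1≤s (≤-trans s≤e (m≤n+m e m)) total Bm+e , s<m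
  where
  Bm+e : Border (at N) (m + e) s
  Bm+e = border-compose (≤-reflexive (trans (+-comm e s) s+e≡m)) Bm
           (border-agree (top-left-agrees N) (≤-reflexive s+e≡m) B)
  total : s + (m + e) ≡ _
  total = begin
    s + (m + e) ≡⟨ sym (+-assoc s m e) ⟩
    s + m + e   ≡⟨ cong (_+ e) (+-comm s m) ⟩
    m + s + e   ≡⟨ +-assoc m s e ⟩
    m + (s + e) ≡⟨ cong (m +_) s+e≡m ⟩
    m + m       ≡⟨ sym p≡m+m ⟩
    _           ∎
  s<m : s < m
  s<m = <-≤-trans (m<m+n s (≤-trans 1≤s s≤e)) (≤-reflexive s+e≡m)

[2+m]/2 : ∀ m → suc (suc m) / 2 ≡ suc (m / 2)
[2+m]/2 m = m/n≡1+[m∸n]/n {suc (suc m)} (s≤s (s≤s z≤n))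

half-odd : ∀ h → suc (h + h) / 2 ≡ h
half-odd zero    = refl
half-odd (suc h) = begin
  suc (suc h + suc h) / 2     ≡⟨ cong (λ x → suc (suc x) / 2) (+-suc h h) ⟩
  suc (suc (suc (h + h))) / 2 ≡⟨ [2+m]/2 (suc (h + h)) ⟩
  suc (suc (h + h) / 2)       ≡⟨ cong suc (half-odd h) ⟩
  suc h                       ∎

half-even : ∀ h → suc (suc (h + h)) / 2 ≡ suc h
half-even h = trans ([2+m]/2 (h + h)) (cong suc (double-half h))
  where
  double-half : ∀ h → (h + h) / 2 ≡ h
  double-half zero    = refl
  double-half (suc h) = begin
    (suc h + suc h) / 2     ≡⟨ cong (λ x → suc x / 2) (+-suc h h) ⟩
    suc (suc (h + h)) / 2   ≡⟨ [2+m]/2 (h + h) ⟩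
    suc ((h + h) / 2)       ≡⟨ cong suc (double-half h) ⟩
    suc h                   ∎

-- The theorem for n = 2h+1 over an alphabet of size q+1. The φ-size
-- ⌊(n+1)/2⌋ = h+1 is passed as d with d ≡ h+1, since the division does not
-- reduce on a variable h.
odd-case : ∀ h q d → d ≡ suc h → (T′ : Mat (suc (suc (h + h))) (suc q)) →
  BBF (suc (suc (h + h))) (suc q) T′ ⇔
    ((Σ[ T ∈ Mat (suc (h + h)) (suc q) ] (BBF (suc (h + h)) (suc q) T × InPsi T T′)) ×
     ¬ (Σ[ D ∈ Mat d (suc q) ] (BBF d (suc q) D × InPhi D T′)))
odd-case h q .(suc h) refl T′ = mk⇔ forward backward
  where
  InPsiOfBBF : Set
  InPsiOfBBF =
    Σ[ T ∈ Mat (suc (h + h)) (suc q) ] (BBF (suc (h + h)) (suc q) T × InPsi T T′)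
  InPhiOfBBF : Set
  InPhiOfBBF = Σ[ D ∈ Mat (suc h) (suc q) ] (BBF (suc h) (suc q) D × InPhi D T′)

  2h+2≡ : suc (suc (h + h)) ≡ suc h + suc h
  2h+2≡ = cong suc (sym (+-suc h h))
  n/2≡h : suc (h + h) / 2 ≡ h
  n/2≡h = half-odd h

  -- T′ bibifix-free: deleting its middle row and column gives a bibifix-free
  -- T (short borders of T lift to T′), and T′ ∉ φ(D) since that would make
  -- its first half repeat.
  forward : BBF (suc (suc (h + h))) (suc q) T′ → InPsiOfBBF × ¬ InPhiOfBBF
  forward bbf′ = (delete h T′ , bbf-T , delete-psi n/2≡h T′) , not-phi
    where
    none′ : ¬ ShortBorder (at T′) (suc (suc (h + h)))
    none′ = Equivalence.to (bbf⇔noShortBorder T′) bbf′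
    bbf-T : BBF (suc (h + h)) (suc q) (delete h T′)
    bbf-T = Equivalence.from (bbf⇔noShortBorder (delete h T′))
      (λ B → none′ (lift-short {h = h} (psi→insertion n/2≡h (delete-psi n/2≡h T′)) B))
    not-phi : ¬ InPhiOfBBF
    not-phi (_ , _ , φ) = none′ (short (s≤s z≤n) ≤-refl (sym 2h+2≡) (phi→border φ))

  -- Conversely a short border of T′ is either at most h in size, and then
  -- comes from T, or is the repetition of the first half D; then T′ ∈ φ(D),
  -- and D is bibifix-free since its short borders give small ones of T′.
  backward : InPsiOfBBF × ¬ InPhiOfBBF → BBF (suc (suc (h + h))) (suc q) T′
  backward ((T , bbf-T , ψ) , not-phi) =
    Equivalence.from (bbf⇔noShortBorder T′) no-short
    where
    small-impossible : (B : ShortBorder (at T′) (suc (suc (h + h)))) →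
      ShortBorder.size B ≤ h → ⊥
    small-impossible B s≤h = Equivalence.to (bbf⇔noShortBorder T) bbf-T
      (lower-short {h = h} (psi→insertion n/2≡h ψ) B s≤h)
    no-short : ¬ ShortBorder (at T′) (suc (suc (h + h)))
    no-short B with even-split 2h+2≡ B
    ... | inj₁ s<h+1 = small-impossible B (≤-pred s<h+1)
    ... | inj₂ Bh+1  = not-phi (top-left (suc h) T′ , bbf-D , border→phi 2h+2≡ T′ Bh+1)
      where
      bbf-D : BBF (suc h) (suc q) (top-left (suc h) T′)
      bbf-D = Equivalence.from (bbf⇔noShortBorder _) λ B′ →
        let (B , s<h+1) = top-left-short T′ 2h+2≡ Bh+1 B′
        in small-impossible B (≤-pred s<h+1)

2k+1≡1+k+k : ∀ k → 2 * k + 1 ≡ suc (k + k)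
2k+1≡1+k+k k = trans (+-comm (2 * k) 1) (cong (λ x → suc (k + x)) (+-identityʳ k))

-- The alphabet is nonempty (q ≥ 1), so q = q′ + 1 as odd-case requires.
proposition3p2 : (q : ℕ) → 1 ≤ q → (n k : ℕ) → n ≡ 2 * k + 1 →
    (T′ : Mat (suc n) q) →
    BBF (suc n) q T′ ⇔
      ((Σ[ T ∈ Mat n q ] (BBF n q T × InPsi T T′)) ×
       ¬ (Σ[ D ∈ Mat (suc n / 2) q ] (BBF (suc n / 2) q D × InPhi D T′)))
proposition3p2 (suc q) _ n k n≡2k+1 T′ with trans n≡2k+1 (2k+1≡1+k+k k)
... | refl = odd-case k q (suc n / 2) (half-even k) T′
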